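{- Let $n$ be a positive integer and let $k\geqslant 0$ be an even integer. Then $$\frac{3^{k+1}+1}{4}E_k\equiv\frac{3^k}{2}\sum_{j=0}^{2^n-1}(-1)^{j-1}(2j+1)^k\left\lfloor\frac{3j+1}{2^n}\right\rfloor\pmod{2^n},$$ and moreover, for every positive odd integer $m$, $$\frac{m^{k+1}-(-1)^{(m-1)/2}}{4}E_k\equiv\frac{m^k}{2}\sum_{j=0}^{2^n-1}(-1)^{j-1}(2j+1)^k\left\lfloor\frac{jm+(m-1)/2}{2^n}\right\rfloor\pmod{2^n}.$$
   Context: The Euler numbers $E_0,E_1,E_2,\ldots$ are the integers defined by $E_0=1$ and $E_n=-\sum_{0\leqslant k\leqslant n-1,\ 2\mid n-k}\binom{n}{k}E_k$ for $n\geqslant 1$ (equivalently $\sec x=\sum_{n\geqslant0}(-1)^nE_{2n}x^{2n}/(2n)!$ and $E_{2n+1}=0$). $\lfloor\alpha\rfloor$ denotes the greatest integer not exceeding $\alpha$. For an integer $q>1$, $\mathbb{Z}_q$ denotes the ring of rationals $a/b$ with $a\in\mathbb{Z}$, $b\in\mathbb{Z}^+$, $\gcd(b,q)=1$; for $\alpha,\beta\in\mathbb{Z}_q$, $\alpha\equiv\beta\pmod q$ means $\alpha-\beta=q\gamma$ for some $\gamma\in\mathbb{Z}_q$. -}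

module Defs where

open import Data.Nat as ℕ using (ℕ; zero; suc; NonZero; _≡ᵇ_)
open import Data.Nat.Properties using (m^n≢0)
open import Data.Nat.Combinatorics using (_C_)
open import Data.Nat.Coprimality using (Coprime)
open import Data.Integer as ℤ using (ℤ; +_)
open import Data.Rational as ℚ using (ℚ)
open import Data.List using (List; []; _∷_; _++_; zipWith; upTo; foldr)
open import Data.Bool using (if_then_else_)
open import Data.Product using (∃; _×_)
open import Relation.Binary.PropositionalEquality using (_≡_)

eulers : ℕ → List ℤ
euler  : ℕ → ℤ
eulers zero    = []
eulers (suc n) = eulers n ++ (euler n ∷ [])
euler zero    = + 1
euler (suc n) =
  ℤ.- foldr ℤ._+_ (+ 0) (zipWith term (upTo (suc n)) (eulers (suc n)))
  where
  term : ℕ → ℤ → ℤ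
  term k e = if (((suc n ℕ.∸ k) ℕ.% 2) ≡ᵇ 0) then (+ (suc n C k)) ℤ.* e else + 0

_div2^_ : ℕ → ℕ → ℕ
a div2^ n = ℕ._/_ a (2 ℕ.^ n) {{m^n≢0 2 n}}

sumℤ : ℕ → (ℕ → ℤ) → ℤ
sumℤ zero    f = + 0
sumℤ (suc N) f = sumℤ N f ℤ.+ f N

-- the ring Z_q: rationals whose (reduced) denominator is coprime to q;
-- α ≡ β (mod q) iff α - β = q γ for some γ ∈ Z_q
InZ : ℕ → ℚ → Set
InZ q γ = Coprime (ℚ.denominatorℕ γ) q

infix 4 _≡_[modℚ_]
_≡_[modℚ_] : ℚ → ℚ → ℕ → Set
α ≡ β [modℚ q ] = ∃ λ γ → InZ q γ × (α ℚ.- β ≡ ((+ q) ℚ./ 1) ℚ.* γ)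

-- the sum  Σ_{j=0}^{2^n-1} (-1)^{j-1} (2j+1)^k ⌊(j m + (m-1)/2) / 2^n⌋
-- ((-1)^{j-1} written as -((-1)^j), valid also for j = 0)
S : ℕ → ℕ → ℕ → ℤ
S n k m = sumℤ (2 ℕ.^ n) λ j →
  (ℤ.- ((ℤ.- (+ 1)) ℤ.^ j)) ℤ.* (+ ((2 ℕ.* j ℕ.+ 1) ℕ.^ k))
    ℤ.* (+ ((j ℕ.* m ℕ.+ (m ℕ.∸ 1) ℕ./ 2) div2^ n))

S3 : ℕ → ℕ → ℤ
S3 n k = sumℤ (2 ℕ.^ n) λ j →
  (ℤ.- ((ℤ.- (+ 1)) ℤ.^ j)) ℤ.* (+ ((2 ℕ.* j ℕ.+ 1) ℕ.^ k))
    ℤ.* (+ ((3 ℕ.* j ℕ.+ 1) div2^ n))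

-- Put q = 2^n, K = k + 1, m = 2h + 1 and A = Σ_{j<q} (-1)^j (2j+1)^K.
-- Telescoping the Euler polynomial identity appell euler K (y + 1) + appell euler K (y - 1) = 2y^K
-- over y = 2j + 1 gives 2A = E_K - appell euler K (2q); expanding in powers of 2q, where
-- E_{K-2} = 0, yields A ≡ -K q E_k (mod 4q²).
-- On the other hand σ(j) = (jm + h) mod q permutes [0, q), with (-1)^σ(j) = (-1)^(j+h) and
-- 2σ(j) + 1 = (2j+1)m - 2q t_j where t_j = ⌊(jm + h)/q⌋. Expanding (2σ(j)+1)^K modulo (2q t_j)²
-- and summing over j yields A ≡ (-1)^h (m^K A + 2qK m^k S) (mod 4q²).
-- Eliminating A gives qK((m^K - (-1)^h) E_k - 2m^k S) ≡ 0 (mod 4q²); cancelling q and the odd K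
-- leaves a congruence modulo 4q, which is the claim after dividing by 4. The first claim is m = 3.

module Submission where

open import Defs
open import Data.Nat as ℕ using (ℕ; zero; suc; _≤_; _<_; z≤n; s≤s; NonZero; _≡ᵇ_)
import Data.Nat.Properties as ℕₚ
open import Data.Nat.DivMod using (m≡m%n+[m/n]*n; m%n<n; m*n/n≡m; m%n%n≡m%n; %-distribˡ-+; [m+kn]%n≡m%n)
open import Data.Nat.Divisibility using (_∣_; divides; >⇒∤)
open import Data.Nat.Coprimality using (1-coprimeTo) renaming (sym to coprime-sym)
open import Data.Nat.Combinatorics using (_C_; nCn≡1; nC1≡n; nCk+nC[k+1]≡[n+1]C[k+1]; k>n⇒nCk≡0)
open import Data.Nat.Induction using (<-rec)
import Data.Nat.Tactic.RingSolver as ℕ-Solver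
open import Data.Integer as ℤ using (ℤ; +_; _+_; _*_; _-_; -_; _^_; ∣_∣)
import Data.Integer.Properties as ℤₚ
open import Data.Integer.Divisibility.Signed
  using (divides; ∣⇒∣ᵤ; ∣-trans; ∣m∣n⇒∣m+n; ∣m∣n⇒∣m-n; ∣n⇒∣m*n; *-monoˡ-∣; *-cancelˡ-∣; *-cancelʳ-∣)
  renaming (_∣_ to _∣ℤ_)
open import Data.Integer.Tactic.RingSolver using (solve-∀)
open import Data.Rational as ℚ using (ℚ; mkℚ)
import Data.Rational.Properties as ℚₚ
open import Data.Rational.Unnormalised as ℚᵘ using (mkℚᵘ; *≡*)
import Data.Rational.Unnormalised.Properties as ℚᵘₚ
open import Data.Fin using (Fin; toℕ; fromℕ<; punchOut)
import Data.Fin.Properties as Finₚ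
open import Data.Fin.Permutation using (Permutation; permutation)
import Algebra.Properties.CommutativeMonoid.Sum as CommutativeMonoidSum
open import Data.Bool using (if_then_else_)
open import Data.List using ([]; _∷_; _++_; zipWith; upTo; foldr; map)
import Data.List.Properties as Listₚ
open import Data.Product using (∃; _×_; _,_; proj₁; proj₂)
open import Function using (_∘_; Injective)
open import Relation.Nullary using (yes; no)
open import Relation.Nullary.Negation using (contradiction)
open import Relation.Binary.PropositionalEquality
open ≡-Reasoning

infix 8 -1^_
-1^_ : ℕ → ℤ
-1^ j = (- + 1) ^ j

sumℤ-cong : ∀ N {f g : ℕ → ℤ} → (∀ {i} → i < N → f i ≡ g i) → sumℤ N f ≡ sumℤ N g
sumℤ-cong zero    f≡g = refl
sumℤ-cong (suc N) f≡g = cong₂ _+_ (sumℤ-cong N (f≡g ∘ ℕₚ.m<n⇒m<1+n)) (f≡g (ℕₚ.n<1+n N))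

sumℤ-suc : ∀ N f → sumℤ (suc N) f ≡ f 0 + sumℤ N (f ∘ suc)
sumℤ-suc zero    f = ℤₚ.+-comm (+ 0) (f 0)
sumℤ-suc (suc N) f = trans (cong (_+ f (suc N)) (sumℤ-suc N f)) (ℤₚ.+-assoc (f 0) _ _)

sumℤ-zero : ∀ N → sumℤ N (λ _ → + 0) ≡ + 0
sumℤ-zero zero    = refl
sumℤ-zero (suc N) = trans (ℤₚ.+-identityʳ _) (sumℤ-zero N)

sumℤ-distrib-+ : ∀ N f g → sumℤ N (λ i → f i + g i) ≡ sumℤ N f + sumℤ N g
sumℤ-distrib-+ zero    f g = refl
sumℤ-distrib-+ (suc N) f g =
  trans (cong (_+ (f N + g N)) (sumℤ-distrib-+ N f g)) (interchange (sumℤ N f) (sumℤ N g) (f N) (g N))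
  where
  interchange : ∀ a b c d → a + b + (c + d) ≡ a + c + (b + d)
  interchange = solve-∀

*-distribˡ-sumℤ : ∀ N c f → c * sumℤ N f ≡ sumℤ N (λ i → c * f i)
*-distribˡ-sumℤ zero    c f = ℤₚ.*-zeroʳ c
*-distribˡ-sumℤ (suc N) c f =
  trans (ℤₚ.*-distribˡ-+ c (sumℤ N f) (f N)) (cong (_+ c * f N) (*-distribˡ-sumℤ N c f))

sumℤ-cong-∣ : ∀ N {d} f g → (∀ {i} → i < N → d ∣ℤ f i - g i) → d ∣ℤ sumℤ N f - sumℤ N g
sumℤ-cong-∣ zero    f g d∣ = divides (+ 0) refl
sumℤ-cong-∣ (suc N) f g d∣ =
  subst (_ ∣ℤ_) (interchange (sumℤ N f) (f N) (sumℤ N g) (g N))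
    (∣m∣n⇒∣m+n (sumℤ-cong-∣ N f g (d∣ ∘ ℕₚ.m<n⇒m<1+n)) (d∣ (ℕₚ.n<1+n N)))
  where
  interchange : ∀ a b c d → a - c + (b - d) ≡ a + b - (c + d)
  interchange = solve-∀

sumℤ-alternating-telescope : ∀ (g : ℕ → ℤ) M → sumℤ M (λ j → -1^ j * (g (suc j) + g j)) ≡ g 0 - -1^ M * g M
sumℤ-alternating-telescope g zero    = sym (trans (cong (_-_ (g 0)) (ℤₚ.*-identityˡ (g 0))) (ℤₚ.+-inverseʳ (g 0)))
sumℤ-alternating-telescope g (suc M) =
  trans (cong (_+ -1^ M * (g (suc M) + g M)) (sumℤ-alternating-telescope g M))
        (cancel (g 0) (-1^ M) (g M) (g (suc M)))
  where
  cancel : ∀ a s b c → a - s * b + s * (c + b) ≡ a - (- + 1) * s * c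
  cancel = solve-∀

module Σ = CommutativeMonoidSum ℤₚ.+-0-commutativeMonoid

sumℤ≡sum : ∀ N f → sumℤ N f ≡ Σ.sum {N} (f ∘ toℕ)
sumℤ≡sum zero    f = refl
sumℤ≡sum (suc N) f = trans (sumℤ-suc N f) (cong (_+_ (f 0)) (sumℤ≡sum N (f ∘ suc)))

injective⇒surjective : ∀ {N} (f : Fin N → Fin N) → Injective _≡_ _≡_ f → ∀ y → ∃ λ x → f x ≡ y
injective⇒surjective {zero}  f f-inj ()
injective⇒surjective {suc N} f f-inj y with Finₚ.any? (λ x → f x Finₚ.≟ y)
... | yes hit = hit
... | no miss = contradiction (Finₚ.injective⇒≤ punchOut∘f-injective) ℕₚ.1+n≰n
  where
  y≢f : ∀ x → y ≢ f x
  y≢f x y≡fx = miss (x , sym y≡fx)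
  punchOut∘f-injective : Injective _≡_ _≡_ (λ x → punchOut (y≢f x))
  punchOut∘f-injective eq = f-inj (Finₚ.punchOut-injective (y≢f _) (y≢f _) eq)

sumℤ-permute : ∀ N (σ : ℕ → ℕ) f → (σ< : ∀ {j} → j < N → σ j < N) →
               (∀ {i j} → i < N → j < N → σ i ≡ σ j → i ≡ j) →
               sumℤ N (f ∘ σ) ≡ sumℤ N f
sumℤ-permute N σ f σ< σ-inj = begin
  sumℤ N (f ∘ σ)                  ≡⟨ sumℤ≡sum N (f ∘ σ) ⟩
  Σ.sum {N} (f ∘ σ ∘ toℕ)         ≡⟨ Σ.sum-cong-≗ {N} (cong f ∘ sym ∘ toℕ-σᶠ) ⟩
  Σ.sum {N} (f ∘ toℕ ∘ σᶠ)        ≡⟨ Σ.sum-permute {N} {N} (f ∘ toℕ) π ⟨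
  Σ.sum {N} (f ∘ toℕ)             ≡⟨ sumℤ≡sum N f ⟨
  sumℤ N f                        ∎
  where
  σᶠ : Fin N → Fin N
  σᶠ i = fromℕ< (σ< (Finₚ.toℕ<n i))
  toℕ-σᶠ : ∀ i → toℕ (σᶠ i) ≡ σ (toℕ i)
  toℕ-σᶠ i = Finₚ.toℕ-fromℕ< (σ< (Finₚ.toℕ<n i))
  σᶠ-injective : Injective _≡_ _≡_ σᶠ
  σᶠ-injective {i} {j} eq = Finₚ.toℕ-injective (σ-inj (Finₚ.toℕ<n i) (Finₚ.toℕ<n j)
    (trans (sym (toℕ-σᶠ i)) (trans (cong toℕ eq) (toℕ-σᶠ j))))
  σᶠ-onto : ∀ y → ∃ λ x → σᶠ x ≡ y
  σᶠ-onto = injective⇒surjective σᶠ σᶠ-injective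
  π : Permutation N N
  π = permutation σᶠ (proj₁ ∘ σᶠ-onto) (proj₂ ∘ σᶠ-onto) (σᶠ-injective ∘ proj₂ ∘ σᶠ-onto ∘ σᶠ)

-- appell euler N y = 2^N E_N((y + 1)/2); the Pascal-type recursion makes appell-translate a plain induction.
appell : (ℕ → ℤ) → ℕ → ℤ → ℤ
appell a zero    y = a 0
appell a (suc N) y = y * appell a N y + appell (a ∘ suc) N y

binomialSum : (ℕ → ℤ) → ℕ → ℤ → ℤ
binomialSum a N y = sumℤ (suc N) (λ i → + (N C i) * a i * y ^ (N ℕ.∸ i))

appell-cong : ∀ N y {a b} → (∀ i → a i ≡ b i) → appell a N y ≡ appell b N y
appell-cong zero    y a≡b = a≡b 0
appell-cong (suc N) y a≡b =
  cong₂ (λ u v → y * u + v) (appell-cong N y a≡b) (appell-cong N y (a≡b ∘ suc))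

appell-+ : ∀ N y a b → appell (λ i → a i + b i) N y ≡ appell a N y + appell b N y
appell-+ zero    y a b = refl
appell-+ (suc N) y a b =
  trans (cong₂ (λ u v → y * u + v) (appell-+ N y a b) (appell-+ N y (a ∘ suc) (b ∘ suc)))
        (interchange y (appell a N y) (appell b N y) (appell (a ∘ suc) N y) (appell (b ∘ suc) N y))
  where
  interchange : ∀ y a b c d → y * (a + b) + (c + d) ≡ y * a + c + (y * b + d)
  interchange = solve-∀

appell-* : ∀ N y c a → appell (λ i → c * a i) N y ≡ c * appell a N y
appell-* zero    y c a = refl
appell-* (suc N) y c a =
  trans (cong₂ (λ u v → y * u + v) (appell-* N y c a) (appell-* N y c (a ∘ suc)))
        (factor y c (appell a N y) (appell (a ∘ suc) N y))
  where
  factor : ∀ y c a b → y * (c * a) + c * b ≡ c * (y * a + b)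
  factor = solve-∀

appell-zero : ∀ N y → appell (λ _ → + 0) N y ≡ + 0
appell-zero zero    y = refl
appell-zero (suc N) y =
  trans (cong (λ u → y * u + u) (appell-zero N y)) (trans (ℤₚ.+-identityʳ (y * + 0)) (ℤₚ.*-zeroʳ y))

δ₀ : ℕ → ℤ
δ₀ zero    = + 1
δ₀ (suc _) = + 0

appell-δ₀ : ∀ N y → appell δ₀ N y ≡ y ^ N
appell-δ₀ zero    y = refl
appell-δ₀ (suc N) y =
  trans (cong₂ (λ u v → y * u + v) (appell-δ₀ N y) (appell-zero N y)) (ℤₚ.+-identityʳ (y * y ^ N))

appell-at-zero : ∀ N a → appell a N (+ 0) ≡ a N
appell-at-zero zero    a = refl
appell-at-zero (suc N) a = trans (ℤₚ.+-identityˡ _) (appell-at-zero N (a ∘ suc))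

appell-translate : ∀ N y z a → appell (λ M → appell a M y) N z ≡ appell a N (y + z)
appell-translate zero    y z a = refl
appell-translate (suc N) y z a = begin
  z * appell (λ M → appell a M y) N z + appell (λ M → y * appell a M y + appell (a ∘ suc) M y) N z
    ≡⟨ cong (_+_ (z * appell (λ M → appell a M y) N z)) (appell-+ N z _ _) ⟩
  z * appell (λ M → appell a M y) N z
    + (appell (λ M → y * appell a M y) N z + appell (λ M → appell (a ∘ suc) M y) N z)
    ≡⟨ cong (λ u → z * appell (λ M → appell a M y) N z + (u + appell (λ M → appell (a ∘ suc) M y) N z))
            (appell-* N z y _) ⟩
  z * appell (λ M → appell a M y) N z
    + (y * appell (λ M → appell a M y) N z + appell (λ M → appell (a ∘ suc) M y) N z)
    ≡⟨ cong₂ (λ u v → z * u + (y * u + v)) (appell-translate N y z a) (appell-translate N y z (a ∘ suc)) ⟩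
  z * appell a N (y + z) + (y * appell a N (y + z) + appell (a ∘ suc) N (y + z))
    ≡⟨ collect y z (appell a N (y + z)) (appell (a ∘ suc) N (y + z)) ⟩
  (y + z) * appell a N (y + z) + appell (a ∘ suc) N (y + z) ∎
  where
  collect : ∀ y z u v → z * u + (y * u + v) ≡ (y + z) * u + v
  collect = solve-∀

raise-binomial-tail : ∀ N (a : ℕ → ℤ) y →
  sumℤ N (λ i → y * (+ (N C suc i) * a (suc i) * y ^ (N ℕ.∸ suc i)))
  ≡ sumℤ (suc N) (λ i → + (N C suc i) * a (suc i) * y ^ (N ℕ.∸ i))
raise-binomial-tail N a y = begin
  sumℤ N (λ i → y * (+ (N C suc i) * a (suc i) * y ^ (N ℕ.∸ suc i)))
    ≡⟨ sumℤ-cong N (λ {i} i<N → trans (cong (λ e → + (N C suc i) * a (suc i) * y ^ e) (ℕₚ.+-∸-assoc 1 i<N))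
                                        (swap y (+ (N C suc i)) (a (suc i)) _)) ⟨
  sumℤ N (λ i → + (N C suc i) * a (suc i) * y ^ (N ℕ.∸ i))
    ≡⟨ ℤₚ.+-identityʳ _ ⟨
  sumℤ N (λ i → + (N C suc i) * a (suc i) * y ^ (N ℕ.∸ i)) + + 0
    ≡⟨ cong (_+_ (sumℤ N (λ i → + (N C suc i) * a (suc i) * y ^ (N ℕ.∸ i)))) last≡0 ⟨
  sumℤ (suc N) (λ i → + (N C suc i) * a (suc i) * y ^ (N ℕ.∸ i)) ∎
  where
  swap : ∀ y c x p → c * x * (y * p) ≡ y * (c * x * p)
  swap = solve-∀
  last≡0 : + (N C suc N) * a (suc N) * y ^ (N ℕ.∸ N) ≡ + 0
  last≡0 = trans (cong (λ c → + c * a (suc N) * y ^ (N ℕ.∸ N)) (k>n⇒nCk≡0 (ℕₚ.n<1+n N)))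
                 (ℤₚ.*-zeroˡ (y ^ (N ℕ.∸ N)))

binomialSum-suc : ∀ N a y → binomialSum a (suc N) y ≡ y * binomialSum a N y + binomialSum (a ∘ suc) N y
binomialSum-suc N a y = begin
  binomialSum a (suc N) y
    ≡⟨ sumℤ-suc (suc N) _ ⟩
  + 1 * a 0 * (y * y ^ N) + sumℤ (suc N) (λ i → + (suc N C suc i) * a (suc i) * y ^ (N ℕ.∸ i))
    ≡⟨ cong (_+_ (+ 1 * a 0 * (y * y ^ N)))
            (trans (sumℤ-cong (suc N) (λ {i} _ → pascal i)) (sumℤ-distrib-+ (suc N) _ _)) ⟩
  + 1 * a 0 * (y * y ^ N) + (binomialSum (a ∘ suc) N y + U)
    ≡⟨ rearrange y (a 0) (y ^ N) (binomialSum (a ∘ suc) N y) U ⟩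
  y * (+ 1 * a 0 * y ^ N) + U + binomialSum (a ∘ suc) N y
    ≡⟨ cong (λ u → y * (+ 1 * a 0 * y ^ N) + u + binomialSum (a ∘ suc) N y) (raise-binomial-tail N a y) ⟨
  y * (+ 1 * a 0 * y ^ N) + sumℤ N (λ i → y * (+ (N C suc i) * a (suc i) * y ^ (N ℕ.∸ suc i)))
    + binomialSum (a ∘ suc) N y
    ≡⟨ cong (_+ binomialSum (a ∘ suc) N y) (trans (*-distribˡ-sumℤ (suc N) y _) (sumℤ-suc N _)) ⟨
  y * binomialSum a N y + binomialSum (a ∘ suc) N y ∎
  where
  U : ℤ
  U = sumℤ (suc N) (λ i → + (N C suc i) * a (suc i) * y ^ (N ℕ.∸ i))
  rearrange : ∀ y a p b u → + 1 * a * (y * p) + (b + u) ≡ y * (+ 1 * a * p) + u + b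
  rearrange = solve-∀
  pascal : ∀ i → + (suc N C suc i) * a (suc i) * y ^ (N ℕ.∸ i)
               ≡ + (N C i) * a (suc i) * y ^ (N ℕ.∸ i) + + (N C suc i) * a (suc i) * y ^ (N ℕ.∸ i)
  pascal i = begin
    + (suc N C suc i) * a (suc i) * y ^ (N ℕ.∸ i)
      ≡⟨ cong (λ c → + c * a (suc i) * y ^ (N ℕ.∸ i)) (nCk+nC[k+1]≡[n+1]C[k+1] N i) ⟨
    (+ (N C i) + + (N C suc i)) * a (suc i) * y ^ (N ℕ.∸ i)
      ≡⟨ distrib (+ (N C i)) (+ (N C suc i)) (a (suc i)) (y ^ (N ℕ.∸ i)) ⟩
    + (N C i) * a (suc i) * y ^ (N ℕ.∸ i) + + (N C suc i) * a (suc i) * y ^ (N ℕ.∸ i) ∎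
    where
    distrib : ∀ c d x z → (c + d) * x * z ≡ c * x * z + d * x * z
    distrib = solve-∀

appell≡binomialSum : ∀ N a y → appell a N y ≡ binomialSum a N y
appell≡binomialSum zero    a y = unit (a 0)
  where
  unit : ∀ x → x ≡ + 0 + + 1 * x * + 1
  unit = solve-∀
appell≡binomialSum (suc N) a y =
  trans (cong₂ (λ u v → y * u + v) (appell≡binomialSum N a y) (appell≡binomialSum N (a ∘ suc) y))
        (sym (binomialSum-suc N a y))

appell-expand₃ : ∀ M a y → ∃ λ r → appell a (2 ℕ.+ M) y
  ≡ a (2 ℕ.+ M) + + (2 ℕ.+ M) * a (1 ℕ.+ M) * y + + ((2 ℕ.+ M) C 2) * a M * (y * y) + y * y * y * r
appell-expand₃ zero    a y = + 0 , expand y (a 0) (a 1) (a 2)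
  where
  expand : ∀ y a b c → y * (y * a + b) + (y * b + c) ≡ c + + 2 * b * y + + 1 * a * (y * y) + y * y * y * + 0
  expand = solve-∀
appell-expand₃ (suc M) a y with appell-expand₃ M a y | appell-expand₃ M (a ∘ suc) y
... | r , eq | r′ , eq′ = + ((2 ℕ.+ M) C 2) * a M + y * r + r′ , (begin
  y * appell a (2 ℕ.+ M) y + appell (a ∘ suc) (2 ℕ.+ M) y
    ≡⟨ cong₂ (λ u v → y * u + v) eq eq′ ⟩
  y * (a (2 ℕ.+ M) + n * a (1 ℕ.+ M) * y + c * a M * (y * y) + y * y * y * r)
    + (a (3 ℕ.+ M) + n * a (2 ℕ.+ M) * y + c * a (1 ℕ.+ M) * (y * y) + y * y * y * r′)
    ≡⟨ expand y (a (3 ℕ.+ M)) (a (2 ℕ.+ M)) (a (1 ℕ.+ M)) (a M) n c r r′ ⟩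
  a (3 ℕ.+ M) + (+ 1 + n) * a (2 ℕ.+ M) * y + (n + c) * a (1 ℕ.+ M) * (y * y) + y * y * y * (c * a M + y * r + r′)
    ≡⟨ cong (λ c′ → a (3 ℕ.+ M) + (+ 1 + n) * a (2 ℕ.+ M) * y + c′ * a (1 ℕ.+ M) * (y * y)
                    + y * y * y * (c * a M + y * r + r′)) pascal ⟩
  a (3 ℕ.+ M) + + (3 ℕ.+ M) * a (2 ℕ.+ M) * y + + ((3 ℕ.+ M) C 2) * a (1 ℕ.+ M) * (y * y)
    + y * y * y * (c * a M + y * r + r′) ∎)
  where
  n c : ℤ
  n = + (2 ℕ.+ M)
  c = + ((2 ℕ.+ M) C 2)
  expand : ∀ y a₃ a₂ a₁ a₀ n c r r′ →
    y * (a₂ + n * a₁ * y + c * a₀ * (y * y) + y * y * y * r) + (a₃ + n * a₂ * y + c * a₁ * (y * y) + y * y * y * r′)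
    ≡ a₃ + (+ 1 + n) * a₂ * y + (n + c) * a₁ * (y * y) + y * y * y * (c * a₀ + y * r + r′)
  expand = solve-∀
  pascal : n + c ≡ + ((3 ℕ.+ M) C 2)
  pascal = cong +_ (trans (cong (ℕ._+ ((2 ℕ.+ M) C 2)) (sym (nC1≡n (2 ℕ.+ M))))
                          (nCk+nC[k+1]≡[n+1]C[k+1] (2 ℕ.+ M) 1))

eulers≡map-euler : ∀ N → eulers N ≡ map euler (upTo N)
eulers≡map-euler zero    = refl
eulers≡map-euler (suc N) = begin
  eulers N ++ (euler N ∷ [])               ≡⟨ cong (_++ (euler N ∷ [])) (eulers≡map-euler N) ⟩
  map euler (upTo N) ++ map euler (N ∷ [])  ≡⟨ Listₚ.map-++ euler (upTo N) (N ∷ []) ⟨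
  map euler (upTo N ++ (N ∷ []))           ≡⟨ cong (map euler) (Listₚ.upTo-∷ʳ N) ⟩
  map euler (upTo (suc N))                 ∎

zipWith-map-diagonal : ∀ (f : ℕ → ℤ → ℤ) (g : ℕ → ℤ) xs → zipWith f xs (map g xs) ≡ map (λ x → f x (g x)) xs
zipWith-map-diagonal f g []       = refl
zipWith-map-diagonal f g (x ∷ xs) = cong (f x (g x) ∷_) (zipWith-map-diagonal f g xs)

foldr-+-init : ∀ xs c → foldr _+_ c xs ≡ foldr _+_ (+ 0) xs + c
foldr-+-init []       c = sym (ℤₚ.+-identityˡ c)
foldr-+-init (x ∷ xs) c = trans (cong (_+_ x) (foldr-+-init xs c)) (sym (ℤₚ.+-assoc x _ c))

foldr-map-upTo≡sumℤ : ∀ (f : ℕ → ℤ) N → foldr _+_ (+ 0) (map f (upTo N)) ≡ sumℤ N f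
foldr-map-upTo≡sumℤ f zero    = refl
foldr-map-upTo≡sumℤ f (suc N) = begin
  foldr _+_ (+ 0) (map f (upTo (suc N)))         ≡⟨ cong (foldr _+_ (+ 0) ∘ map f) (Listₚ.upTo-∷ʳ N) ⟨
  foldr _+_ (+ 0) (map f (upTo N ++ (N ∷ [])))   ≡⟨ cong (foldr _+_ (+ 0)) (Listₚ.map-++ f (upTo N) (N ∷ [])) ⟩
  foldr _+_ (+ 0) (map f (upTo N) ++ (f N ∷ [])) ≡⟨ Listₚ.foldr-++ _+_ (+ 0) (map f (upTo N)) (f N ∷ []) ⟩
  foldr _+_ (f N + + 0) (map f (upTo N))         ≡⟨ foldr-+-init (map f (upTo N)) _ ⟩
  foldr _+_ (+ 0) (map f (upTo N)) + (f N + + 0) ≡⟨ cong₂ _+_ (foldr-map-upTo≡sumℤ f N) (ℤₚ.+-identityʳ (f N)) ⟩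
  sumℤ N f + f N                                 ∎

foldr-zipWith-eulers : ∀ (f : ℕ → ℤ → ℤ) N →
  foldr _+_ (+ 0) (zipWith f (upTo N) (eulers N)) ≡ sumℤ N (λ i → f i (euler i))
foldr-zipWith-eulers f N = begin
  foldr _+_ (+ 0) (zipWith f (upTo N) (eulers N))
    ≡⟨ cong (foldr _+_ (+ 0) ∘ zipWith f (upTo N)) (eulers≡map-euler N) ⟩
  foldr _+_ (+ 0) (zipWith f (upTo N) (map euler (upTo N)))
    ≡⟨ cong (foldr _+_ (+ 0)) (zipWith-map-diagonal f euler (upTo N)) ⟩
  foldr _+_ (+ 0) (map (λ i → f i (euler i)) (upTo N))
    ≡⟨ foldr-map-upTo≡sumℤ _ N ⟩
  sumℤ N (λ i → f i (euler i)) ∎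

eulerTerm : ℕ → ℕ → ℤ
eulerTerm N i = if (N ℕ.∸ i) ℕ.% 2 ≡ᵇ 0 then + (N C i) * euler i else + 0

euler-suc : ∀ n → euler (suc n) ≡ - sumℤ (suc n) (eulerTerm (suc n))
euler-suc n = cong -_ (foldr-zipWith-eulers _ (suc n))

odd∸even⇒odd : ∀ {N i} → i ≤ N → N ℕ.% 2 ≡ 1 → (N ℕ.∸ i) ℕ.% 2 ≡ 0 → i ℕ.% 2 ≡ 1
odd∸even⇒odd {N} {i} i≤N N-odd N∸i-even = begin
  i ℕ.% 2                               ≡⟨ m%n%n≡m%n i 2 ⟨
  (0 ℕ.+ i ℕ.% 2) ℕ.% 2                 ≡⟨ cong (λ r → (r ℕ.+ i ℕ.% 2) ℕ.% 2) N∸i-even ⟨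
  ((N ℕ.∸ i) ℕ.% 2 ℕ.+ i ℕ.% 2) ℕ.% 2   ≡⟨ %-distribˡ-+ (N ℕ.∸ i) i 2 ⟨
  (N ℕ.∸ i ℕ.+ i) ℕ.% 2                 ≡⟨ cong (ℕ._% 2) (ℕₚ.m∸n+n≡m i≤N) ⟩
  N ℕ.% 2                               ≡⟨ N-odd ⟩
  1                                     ∎

euler-odd : ∀ N → N ℕ.% 2 ≡ 1 → euler N ≡ + 0
euler-odd = <-rec (λ N → N ℕ.% 2 ≡ 1 → euler N ≡ + 0) vanish
  where
  vanish : ∀ N → (∀ {i} → i < N → i ℕ.% 2 ≡ 1 → euler i ≡ + 0) → N ℕ.% 2 ≡ 1 → euler N ≡ + 0
  vanish (suc n) below N-odd =
    trans (euler-suc n) (cong -_ (trans (sumℤ-cong (suc n) term≡0) (sumℤ-zero (suc n))))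
    where
    term≡0 : ∀ {i} → i < suc n → eulerTerm (suc n) i ≡ + 0
    term≡0 {i} i<N with (suc n ℕ.∸ i) ℕ.% 2 in N∸i%2
    ... | zero  = trans (cong (+ (suc n C i) *_) (below i<N (odd∸even⇒odd (ℕₚ.<⇒≤ i<N) N-odd N∸i%2)))
                        (ℤₚ.*-zeroʳ (+ (suc n C i)))
    ... | suc _ = refl

±1-power-sum : ∀ d x → x * (+ 1) ^ d + x * (- + 1) ^ d ≡ + 2 * (if d ℕ.% 2 ≡ᵇ 0 then x else + 0)
±1-power-sum zero          x = double x
  where
  double : ∀ x → x * + 1 + x * + 1 ≡ + 2 * x
  double = solve-∀
±1-power-sum (suc zero)    x = cancel x
  where
  cancel : ∀ x → x * (+ 1 * + 1) + x * (- + 1 * + 1) ≡ + 2 * + 0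
  cancel = solve-∀
±1-power-sum (suc (suc d)) x = trans (square-signs x ((+ 1) ^ d) ((- + 1) ^ d)) (±1-power-sum d x)
  where
  square-signs : ∀ x p s → x * (+ 1 * (+ 1 * p)) + x * (- + 1 * (- + 1 * s)) ≡ x * p + x * s
  square-signs = solve-∀

appell-euler-±1 : ∀ M → appell euler M (+ 1) + appell euler M (- + 1) ≡ + 2 * δ₀ M
appell-euler-±1 zero    = refl
appell-euler-±1 (suc n) = begin
  appell euler N (+ 1) + appell euler N (- + 1)
    ≡⟨ cong₂ _+_ (appell≡binomialSum N euler (+ 1)) (appell≡binomialSum N euler (- + 1)) ⟩
  binomialSum euler N (+ 1) + binomialSum euler N (- + 1)
    ≡⟨ sumℤ-distrib-+ (suc N) _ _ ⟨
  sumℤ (suc N) (λ i → + (N C i) * euler i * (+ 1) ^ (N ℕ.∸ i) + + (N C i) * euler i * (- + 1) ^ (N ℕ.∸ i))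
    ≡⟨ sumℤ-cong (suc N) (λ {i} _ → ±1-power-sum (N ℕ.∸ i) (+ (N C i) * euler i)) ⟩
  sumℤ (suc N) (λ i → + 2 * eulerTerm N i)
    ≡⟨ *-distribˡ-sumℤ (suc N) (+ 2) (eulerTerm N) ⟨
  + 2 * (sumℤ N (eulerTerm N) + eulerTerm N N)
    ≡⟨ cong (λ s → + 2 * (s + eulerTerm N N)) (ℤₚ.neg-involutive (sumℤ N (eulerTerm N))) ⟨
  + 2 * (- - sumℤ N (eulerTerm N) + eulerTerm N N)
    ≡⟨ cong₂ (λ e t → + 2 * (- e + t)) (euler-suc n) (sym eulerTerm-diagonal) ⟨
  + 2 * (- euler N + euler N)
    ≡⟨ cong (+ 2 *_) (ℤₚ.+-inverseˡ (euler N)) ⟩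
  + 0 ∎
  where
  N : ℕ
  N = suc n
  eulerTerm-diagonal : eulerTerm N N ≡ euler N
  eulerTerm-diagonal = begin
    eulerTerm N N
      ≡⟨ cong (λ d → if d ℕ.% 2 ≡ᵇ 0 then + (N C N) * euler N else + 0) (ℕₚ.n∸n≡0 N) ⟩
    + (N C N) * euler N
      ≡⟨ cong (λ c → + c * euler N) (nCn≡1 N) ⟩
    + 1 * euler N
      ≡⟨ ℤₚ.*-identityˡ (euler N) ⟩
    euler N ∎

appell-euler-shift : ∀ N y → appell euler N (y + + 1) + appell euler N (y - + 1) ≡ + 2 * y ^ N
appell-euler-shift N y = begin
  appell euler N (y + + 1) + appell euler N (y - + 1)
    ≡⟨ cong₂ (λ u v → appell euler N u + appell euler N v) (ℤₚ.+-comm y (+ 1)) (ℤₚ.+-comm y (- + 1)) ⟩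
  appell euler N (+ 1 + y) + appell euler N (- + 1 + y)
    ≡⟨ cong₂ _+_ (appell-translate N (+ 1) y euler) (appell-translate N (- + 1) y euler) ⟨
  appell (λ M → appell euler M (+ 1)) N y + appell (λ M → appell euler M (- + 1)) N y
    ≡⟨ appell-+ N y _ _ ⟨
  appell (λ M → appell euler M (+ 1) + appell euler M (- + 1)) N y
    ≡⟨ appell-cong N y appell-euler-±1 ⟩
  appell (λ M → + 2 * δ₀ M) N y
    ≡⟨ appell-* N y (+ 2) δ₀ ⟩
  + 2 * appell δ₀ N y
    ≡⟨ cong (+ 2 *_) (appell-δ₀ N y) ⟩
  + 2 * y ^ N ∎

-1^-even : ∀ t → -1^ (2 ℕ.* t) ≡ + 1
-1^-even t = trans (sym (ℤₚ.^-*-assoc (- + 1) 2 t)) (ℤₚ.^-zeroˡ t)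

altPowerSum : ℕ → ℕ → ℤ
altPowerSum q K = sumℤ q (λ j → -1^ j * (+ (2 ℕ.* j ℕ.+ 1)) ^ K)

altPowerSum-euler : ∀ q K → 2 ∣ q → + 2 * altPowerSum q K ≡ euler K - appell euler K (+ 2 * + q)
altPowerSum-euler q K (divides t refl) = begin
  + 2 * altPowerSum q K
    ≡⟨ *-distribˡ-sumℤ q (+ 2) _ ⟩
  sumℤ q (λ j → + 2 * (-1^ j * (+ (2 ℕ.* j ℕ.+ 1)) ^ K))
    ≡⟨ sumℤ-cong q (λ {j} _ → by-shift j) ⟩
  sumℤ q (λ j → -1^ j * (g (suc j) + g j))
    ≡⟨ sumℤ-alternating-telescope g q ⟩
  g 0 - -1^ q * g q
    ≡⟨ cong₂ (λ u s → u - s * g q) (appell-at-zero K euler) (trans (cong -1^_ (ℕₚ.*-comm t 2)) (-1^-even t)) ⟩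
  euler K - + 1 * g q
    ≡⟨ cong (_-_ (euler K)) (trans (ℤₚ.*-identityˡ (g q)) (cong (appell euler K) (ℤₚ.pos-* 2 q))) ⟩
  euler K - appell euler K (+ 2 * + q) ∎
  where
  g : ℕ → ℤ
  g j = appell euler K (+ (2 ℕ.* j))
  by-shift : ∀ j → + 2 * (-1^ j * (+ (2 ℕ.* j ℕ.+ 1)) ^ K) ≡ -1^ j * (g (suc j) + g j)
  by-shift j = begin
    + 2 * (-1^ j * Y ^ K)                                   ≡⟨ ℤₚ.*-comm (+ 2) _ ⟩
    -1^ j * Y ^ K * + 2                                     ≡⟨ ℤₚ.*-assoc (-1^ j) _ _ ⟩
    -1^ j * (Y ^ K * + 2)                                   ≡⟨ cong (-1^ j *_) (ℤₚ.*-comm (Y ^ K) (+ 2)) ⟩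
    -1^ j * (+ 2 * Y ^ K)                                   ≡⟨ cong (-1^ j *_) (appell-euler-shift K Y) ⟨
    -1^ j * (appell euler K (Y + + 1) + appell euler K (Y - + 1))
      ≡⟨ cong₂ (λ u v → -1^ j * (appell euler K u + appell euler K v)) Y+1 Y-1 ⟩
    -1^ j * (g (suc j) + g j)                               ∎
    where
    Y : ℤ
    Y = + (2 ℕ.* j ℕ.+ 1)
    Y+1 : Y + + 1 ≡ + (2 ℕ.* suc j)
    Y+1 = cong +_ (twice-suc j)
      where
      twice-suc : ∀ j → 2 ℕ.* j ℕ.+ 1 ℕ.+ 1 ≡ 2 ℕ.* suc j
      twice-suc = ℕ-Solver.solve-∀
    Y-1 : Y - + 1 ≡ + (2 ℕ.* j)
    Y-1 = trans (cong (_- + 1) (ℤₚ.pos-+ (2 ℕ.* j) 1)) (cancel (+ (2 ℕ.* j)))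
      where
      cancel : ∀ x → x + + 1 - + 1 ≡ x
      cancel = solve-∀

-- Stated for an arbitrary sequence: at euler with successor-shaped indices, conversion checking
-- unfolds the recursion defining euler and exhausts memory.
appell-halving-congruence : ∀ k (a : ℕ → ℤ) A Q → (∀ {M} → k ≡ suc M → a M ≡ + 0) →
  + 2 * A ≡ a (suc k) - appell a (suc k) (+ 2 * Q) →
  + 4 * (Q * Q) ∣ℤ A + + suc k * Q * a k
appell-halving-congruence zero    a A Q _ halving = divides (+ 0) (ℤₚ.*-cancelˡ-≡ (+ 2) _ _ (begin
  + 2 * (A + + 1 * Q * a 0)                              ≡⟨ ℤₚ.*-distribˡ-+ (+ 2) A _ ⟩
  + 2 * A + + 2 * (+ 1 * Q * a 0)                        ≡⟨ cong (_+ + 2 * (+ 1 * Q * a 0)) halving ⟩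
  a 1 - ((+ 2 * Q) * a 0 + a 1) + + 2 * (+ 1 * Q * a 0)  ≡⟨ cancel (a 0) (a 1) Q ⟩
  + 2 * (+ 0 * (+ 4 * (Q * Q)))                          ∎))
  where
  cancel : ∀ a₀ a₁ Q → a₁ - ((+ 2 * Q) * a₀ + a₁) + + 2 * (+ 1 * Q * a₀) ≡ + 2 * (+ 0 * (+ 4 * (Q * Q)))
  cancel = solve-∀
appell-halving-congruence (suc M) a A Q vanishes halving with appell-expand₃ M a (+ 2 * Q)
... | r , expansion = divides (- (Q * r)) (ℤₚ.*-cancelˡ-≡ (+ 2) _ _ (begin
  + 2 * (A + K * Q * a (1 ℕ.+ M))
    ≡⟨ ℤₚ.*-distribˡ-+ (+ 2) A _ ⟩
  + 2 * A + + 2 * (K * Q * a (1 ℕ.+ M))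
    ≡⟨ cong (_+ + 2 * (K * Q * a (1 ℕ.+ M))) (trans halving (cong (_-_ (a (2 ℕ.+ M))) expansion)) ⟩
  a (2 ℕ.+ M) - (a (2 ℕ.+ M) + K * a (1 ℕ.+ M) * y + c * a M * (y * y) + y * y * y * r)
    + + 2 * (K * Q * a (1 ℕ.+ M))
    ≡⟨ cong (λ e → a (2 ℕ.+ M) - (a (2 ℕ.+ M) + K * a (1 ℕ.+ M) * y + c * e * (y * y) + y * y * y * r)
                   + + 2 * (K * Q * a (1 ℕ.+ M)))
            (vanishes refl) ⟩
  a (2 ℕ.+ M) - (a (2 ℕ.+ M) + K * a (1 ℕ.+ M) * y + c * + 0 * (y * y) + y * y * y * r)
    + + 2 * (K * Q * a (1 ℕ.+ M))
    ≡⟨ cancel (a (2 ℕ.+ M)) K (a (1 ℕ.+ M)) c Q r ⟩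
  + 2 * (- (Q * r) * (+ 4 * (Q * Q))) ∎))
  where
  K c y : ℤ
  K = + (2 ℕ.+ M)
  c = + ((2 ℕ.+ M) C 2)
  y = + 2 * Q
  cancel : ∀ e K a₁ c Q r →
    e - (e + K * a₁ * (+ 2 * Q) + c * + 0 * ((+ 2 * Q) * (+ 2 * Q)) + (+ 2 * Q) * (+ 2 * Q) * (+ 2 * Q) * r)
      + + 2 * (K * Q * a₁)
    ≡ + 2 * (- (Q * r) * (+ 4 * (Q * Q)))
  cancel = solve-∀

1+m≡n*2⇒m%2≡1 : ∀ {m} n → suc m ≡ n ℕ.* 2 → m ℕ.% 2 ≡ 1
1+m≡n*2⇒m%2≡1 (suc n) refl = [m+kn]%n≡m%n 1 n 2

altPowerSum-congruence : ∀ q k → 2 ∣ q → 2 ∣ k →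
  + 4 * (+ q * + q) ∣ℤ altPowerSum q (suc k) + + suc k * + q * euler k
altPowerSum-congruence q k q-even (divides k₀ k≡k₀*2) =
  appell-halving-congruence k euler (altPowerSum q (suc k)) (+ q) below-is-odd (altPowerSum-euler q (suc k) q-even)
  where
  below-is-odd : ∀ {M} → k ≡ suc M → euler M ≡ + 0
  below-is-odd {M} k≡1+M = euler-odd M (1+m≡n*2⇒m%2≡1 k₀ (trans (sym k≡1+M) k≡k₀*2))

2∣odd*x⇒2∣x : ∀ r {x} → + 2 ∣ℤ + suc (r ℕ.* 2) * x → + 2 ∣ℤ x
2∣odd*x⇒2∣x r {x} (divides c mx≡c*2) = divides (c - + r * x) (begin
  x                                        ≡⟨ split x (+ r) ⟩
  (+ 1 + + r * + 2) * x - + r * x * + 2    ≡⟨ cong (λ m → (+ 1 + m) * x - + r * x * + 2) (ℤₚ.pos-* r 2) ⟨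
  + suc (r ℕ.* 2) * x - + r * x * + 2      ≡⟨ cong (_- + r * x * + 2) mx≡c*2 ⟩
  c * + 2 - + r * x * + 2                  ≡⟨ factor c (+ r) x ⟩
  (c - + r * x) * + 2                      ∎)
  where
  split : ∀ x r → x ≡ (+ 1 + r * + 2) * x - r * x * + 2
  split = solve-∀
  factor : ∀ c r x → c * + 2 - r * x * + 2 ≡ (c - r * x) * + 2
  factor = solve-∀

2^a∣odd*x⇒2^a∣x : ∀ a r {x} → + (2 ℕ.^ a) ∣ℤ + suc (r ℕ.* 2) * x → + (2 ℕ.^ a) ∣ℤ x
2^a∣odd*x⇒2^a∣x zero    r {x} _        = divides x (sym (ℤₚ.*-identityʳ x))
2^a∣odd*x⇒2^a∣x (suc a) r 2^[1+a]∣mx = halve 2^[1+a]∣mx (2∣odd*x⇒2∣x r (∣-trans 2∣2^[1+a] 2^[1+a]∣mx))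
  where
  m : ℤ
  m = + suc (r ℕ.* 2)
  2^[1+a]≡2^a*2 : + (2 ℕ.^ suc a) ≡ + (2 ℕ.^ a) * + 2
  2^[1+a]≡2^a*2 = trans (ℤₚ.pos-* 2 (2 ℕ.^ a)) (ℤₚ.*-comm (+ 2) (+ (2 ℕ.^ a)))
  2∣2^[1+a] : + 2 ∣ℤ + (2 ℕ.^ suc a)
  2∣2^[1+a] = divides (+ (2 ℕ.^ a)) 2^[1+a]≡2^a*2
  halve : ∀ {x} → + (2 ℕ.^ suc a) ∣ℤ m * x → + 2 ∣ℤ x → + (2 ℕ.^ suc a) ∣ℤ x
  halve 2^[1+a]∣mx (divides x′ refl) = subst (_∣ℤ x′ * + 2) (sym 2^[1+a]≡2^a*2)
    (*-monoˡ-∣ (+ 2) (2^a∣odd*x⇒2^a∣x a r {x′} (*-cancelʳ-∣ (+ 2) {+ (2 ℕ.^ a)} {m * x′}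
      (subst₂ _∣ℤ_ 2^[1+a]≡2^a*2 (sym (ℤₚ.*-assoc m x′ (+ 2))) 2^[1+a]∣mx))))

∣-difference⇒≡ : ∀ {q i j} → i < q → j < q → + q ∣ℤ + i - + j → i ≡ j
∣-difference⇒≡ {q} {i} {j} i<q j<q q∣i-j with ∣ + i - + j ∣ in dist
... | zero  = ℤₚ.+-injective (ℤₚ.i-j≡0⇒i≡j (+ i) (+ j) (ℤₚ.∣i∣≡0⇒i≡0 dist))
... | suc _ = contradiction (subst (q ∣_) dist (∣⇒∣ᵤ q∣i-j)) (>⇒∤ (subst (_< q) dist dist<q))
  where
  dist<q : ∣ + i - + j ∣ < q
  dist<q = ℕₚ.≤-<-trans (subst (_≤ i ℕ.⊔ j) (cong ∣_∣ (sym (ℤₚ.[+m]-[+n]≡m⊖n i j))) (ℤₚ.∣m⊝n∣≤m⊔n i j))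
                        (ℕₚ.⊔-lub i<q j<q)

affine-%-injective : ∀ n r c {i j} → i < 2 ℕ.^ n → j < 2 ℕ.^ n →
  ((i ℕ.* suc (r ℕ.* 2) ℕ.+ c) ℕ.% 2 ℕ.^ n) {{ℕₚ.m^n≢0 2 n}}
    ≡ ((j ℕ.* suc (r ℕ.* 2) ℕ.+ c) ℕ.% 2 ℕ.^ n) {{ℕₚ.m^n≢0 2 n}} → i ≡ j
affine-%-injective n r c {i} {j} i<q j<q σi≡σj =
  ∣-difference⇒≡ i<q j<q (2^a∣odd*x⇒2^a∣x n r (divides (t i - t j) m[i-j]≡[ti-tj]q))
  where
  q m : ℕ
  q = 2 ℕ.^ n
  m = suc (r ℕ.* 2)
  instance
    q≢0 : NonZero q
    q≢0 = ℕₚ.m^n≢0 2 n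
  A : ℕ → ℕ
  A x = x ℕ.* m ℕ.+ c
  t : ℕ → ℤ
  t x = + (A x ℕ./ q)
  division : ∀ x → + x * + m + + c ≡ + (A x ℕ.% q) + t x * + q
  division x = begin
    + x * + m + + c                    ≡⟨ cong (_+ + c) (ℤₚ.pos-* x m) ⟨
    + (x ℕ.* m) + + c                  ≡⟨ ℤₚ.pos-+ (x ℕ.* m) c ⟨
    + A x                              ≡⟨ cong +_ (m≡m%n+[m/n]*n (A x) q) ⟩
    + (A x ℕ.% q ℕ.+ A x ℕ./ q ℕ.* q)  ≡⟨ ℤₚ.pos-+ (A x ℕ.% q) _ ⟩
    + (A x ℕ.% q) + + (A x ℕ./ q ℕ.* q) ≡⟨ cong (_+_ (+ (A x ℕ.% q))) (ℤₚ.pos-* (A x ℕ./ q) q) ⟩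
    + (A x ℕ.% q) + t x * + q          ∎
  m[i-j]≡[ti-tj]q : + m * (+ i - + j) ≡ (t i - t j) * + q
  m[i-j]≡[ti-tj]q = begin
    + m * (+ i - + j)                                          ≡⟨ expand (+ i) (+ j) (+ m) (+ c) ⟩
    (+ i * + m + + c) - (+ j * + m + + c)                      ≡⟨ cong₂ _-_ (division i) (division j) ⟩
    (+ (A i ℕ.% q) + t i * + q) - (+ (A j ℕ.% q) + t j * + q)  ≡⟨ cong (λ s → (+ s + t i * + q) - (+ (A j ℕ.% q) + t j * + q)) σi≡σj ⟩
    (+ (A j ℕ.% q) + t i * + q) - (+ (A j ℕ.% q) + t j * + q)  ≡⟨ collect (+ (A j ℕ.% q)) (t i) (t j) (+ q) ⟩
    (t i - t j) * + q                                          ∎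
    where
    expand : ∀ i j m c → m * (i - j) ≡ (i * m + c) - (j * m + c)
    expand = solve-∀
    collect : ∀ s u v q → (s + u * q) - (s + v * q) ≡ (u - v) * q
    collect = solve-∀

-1^-% : ∀ n x → -1^ ((x ℕ.% 2 ℕ.^ suc n) {{ℕₚ.m^n≢0 2 (suc n)}}) ≡ -1^ x
-1^-% n x = begin
  -1^ (x ℕ.% q)                           ≡⟨ ℤₚ.*-identityʳ _ ⟨
  -1^ (x ℕ.% q) * + 1                     ≡⟨ cong (-1^ (x ℕ.% q) *_) (trans (cong -1^_ multiple) (-1^-even (x ℕ./ q ℕ.* 2 ℕ.^ n))) ⟨
  -1^ (x ℕ.% q) * -1^ (x ℕ./ q ℕ.* q)     ≡⟨ ℤₚ.^-distribˡ-+-* (- + 1) (x ℕ.% q) _ ⟨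
  -1^ (x ℕ.% q ℕ.+ x ℕ./ q ℕ.* q)         ≡⟨ cong -1^_ (m≡m%n+[m/n]*n x q) ⟨
  -1^ x                                   ∎
  where
  q : ℕ
  q = 2 ℕ.^ suc n
  instance
    q≢0 : NonZero q
    q≢0 = ℕₚ.m^n≢0 2 (suc n)
  multiple : x ℕ./ q ℕ.* q ≡ 2 ℕ.* (x ℕ./ q ℕ.* 2 ℕ.^ n)
  multiple = reassoc (x ℕ./ q) (2 ℕ.^ n)
    where
    reassoc : ∀ a b → a ℕ.* (2 ℕ.* b) ≡ 2 ℕ.* (a ℕ.* b)
    reassoc = ℕ-Solver.solve-∀

pos-^ : ∀ a b → + (a ℕ.^ b) ≡ (+ a) ^ b
pos-^ a zero    = refl
pos-^ a (suc b) = trans (ℤₚ.pos-* a (a ℕ.^ b)) (cong (+ a *_) (pos-^ a b))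

^-distribʳ-* : ∀ x y n → (x * y) ^ n ≡ x ^ n * y ^ n
^-distribʳ-* x y zero    = refl
^-distribʳ-* x y (suc n) = trans (cong (x * y *_) (^-distribʳ-* x y n)) (interchange x y (x ^ n) (y ^ n))
  where
  interchange : ∀ x y a b → x * y * (a * b) ≡ x * a * (y * b)
  interchange = solve-∀

binomial-mod-square : ∀ k X b → ∃ λ R → (X - b) ^ suc k ≡ X ^ suc k - + suc k * X ^ k * b + b * b * R
binomial-mod-square zero    X b = + 0 , linear X b
  where
  linear : ∀ X b → (X - b) * + 1 ≡ X * + 1 - + 1 * + 1 * b + b * b * + 0
  linear = solve-∀
binomial-mod-square (suc k) X b with binomial-mod-square k X b
... | R , eq = + suc k * X ^ k + (X - b) * R ,
               trans (cong ((X - b) *_) eq) (step X b (X ^ k) R (+ suc k))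
  where
  step : ∀ X b P R K → (X - b) * (X * P - K * P * b + b * b * R)
                       ≡ X * (X * P) - (+ 1 + K) * (X * P) * b + b * b * (K * P + (X - b) * R)
  step = solve-∀

-1^-affine : ∀ j h → -1^ (j ℕ.* suc (h ℕ.* 2) ℕ.+ h) ≡ -1^ j * -1^ h
-1^-affine j h = begin
  -1^ (j ℕ.* suc (h ℕ.* 2) ℕ.+ h)          ≡⟨ cong -1^_ (regroup j h) ⟩
  -1^ (2 ℕ.* (j ℕ.* h) ℕ.+ (j ℕ.+ h))      ≡⟨ ℤₚ.^-distribˡ-+-* (- + 1) (2 ℕ.* (j ℕ.* h)) (j ℕ.+ h) ⟩
  -1^ (2 ℕ.* (j ℕ.* h)) * -1^ (j ℕ.+ h)    ≡⟨ cong₂ _*_ (-1^-even (j ℕ.* h)) (ℤₚ.^-distribˡ-+-* (- + 1) j h) ⟩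
  + 1 * (-1^ j * -1^ h)                    ≡⟨ ℤₚ.*-identityˡ _ ⟩
  -1^ j * -1^ h                            ∎
  where
  regroup : ∀ j h → j ℕ.* suc (h ℕ.* 2) ℕ.+ h ≡ 2 ℕ.* (j ℕ.* h) ℕ.+ (j ℕ.+ h)
  regroup = ℕ-Solver.solve-∀

module Permuted (n h k : ℕ) where

  q m K : ℕ
  q = 2 ℕ.^ suc n
  m = suc (h ℕ.* 2)
  K = suc k

  Q M χ : ℤ
  Q = + q
  M = + m
  χ = -1^ h

  instance
    q≢0 : NonZero q
    q≢0 = ℕₚ.m^n≢0 2 (suc n)

  a σ t : ℕ → ℕ
  a j = j ℕ.* m ℕ.+ h
  σ j = a j ℕ.% q
  t j = a j ℕ./ q

  g w : ℕ → ℤ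
  g s = -1^ s * (+ (2 ℕ.* s ℕ.+ 1)) ^ K
  -- w j is verbatim the j-th summand of S (suc n) k m.
  w j = - -1^ j * + ((2 ℕ.* j ℕ.+ 1) ℕ.^ k) * + ((j ℕ.* m ℕ.+ (m ℕ.∸ 1) ℕ./ 2) div2^ suc n)

  α β : ℤ
  α = χ * M ^ K
  β = + 2 * Q * + K * χ * M ^ k

  σ<q : ∀ {j} → j < q → σ j < q
  σ<q {j} _ = m%n<n (a j) q

  σ-injective : ∀ {i j} → i < q → j < q → σ i ≡ σ j → i ≡ j
  σ-injective = affine-%-injective (suc n) h h

  -1^σ : ∀ j → -1^ (σ j) ≡ -1^ j * χ
  -1^σ j = trans (-1^-% n (a j)) (-1^-affine j h)

  2σ+1 : ∀ j → + (2 ℕ.* σ j ℕ.+ 1) ≡ + (2 ℕ.* j ℕ.+ 1) * M - + 2 * Q * + t j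
  2σ+1 j = begin
    + (2 ℕ.* σ j ℕ.+ 1)                                   ≡⟨ add-sub (+ (2 ℕ.* σ j ℕ.+ 1)) (+ 2 * Q * + t j) ⟩
    + (2 ℕ.* σ j ℕ.+ 1) + + 2 * Q * + t j - + 2 * Q * + t j ≡⟨ cong (_- + 2 * Q * + t j) ℤ-form ⟩
    + (2 ℕ.* j ℕ.+ 1) * M - + 2 * Q * + t j               ∎
    where
    add-sub : ∀ x b → x ≡ x + b - b
    add-sub = solve-∀
    ℕ-form : 2 ℕ.* σ j ℕ.+ 1 ℕ.+ 2 ℕ.* q ℕ.* t j ≡ (2 ℕ.* j ℕ.+ 1) ℕ.* m
    ℕ-form = begin
      2 ℕ.* σ j ℕ.+ 1 ℕ.+ 2 ℕ.* q ℕ.* t j   ≡⟨ regroup (σ j) (t j) q ⟩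
      2 ℕ.* (σ j ℕ.+ t j ℕ.* q) ℕ.+ 1       ≡⟨ cong (λ x → 2 ℕ.* x ℕ.+ 1) (m≡m%n+[m/n]*n (a j) q) ⟨
      2 ℕ.* a j ℕ.+ 1                       ≡⟨ factor j h ⟩
      (2 ℕ.* j ℕ.+ 1) ℕ.* m                 ∎
      where
      regroup : ∀ s t q → 2 ℕ.* s ℕ.+ 1 ℕ.+ 2 ℕ.* q ℕ.* t ≡ 2 ℕ.* (s ℕ.+ t ℕ.* q) ℕ.+ 1
      regroup = ℕ-Solver.solve-∀
      factor : ∀ j h → 2 ℕ.* (j ℕ.* suc (h ℕ.* 2) ℕ.+ h) ℕ.+ 1 ≡ (2 ℕ.* j ℕ.+ 1) ℕ.* suc (h ℕ.* 2)
      factor = ℕ-Solver.solve-∀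
    ℤ-form : + (2 ℕ.* σ j ℕ.+ 1) + + 2 * Q * + t j ≡ + (2 ℕ.* j ℕ.+ 1) * M
    ℤ-form = begin
      + (2 ℕ.* σ j ℕ.+ 1) + + 2 * Q * + t j         ≡⟨ cong (_+_ (+ (2 ℕ.* σ j ℕ.+ 1)))
                                                          (trans (ℤₚ.pos-* (2 ℕ.* q) (t j)) (cong (_* + t j) (ℤₚ.pos-* 2 q))) ⟨
      + (2 ℕ.* σ j ℕ.+ 1) + + (2 ℕ.* q ℕ.* t j)      ≡⟨ ℤₚ.pos-+ (2 ℕ.* σ j ℕ.+ 1) _ ⟨
      + (2 ℕ.* σ j ℕ.+ 1 ℕ.+ 2 ℕ.* q ℕ.* t j)        ≡⟨ cong +_ ℕ-form ⟩
      + ((2 ℕ.* j ℕ.+ 1) ℕ.* m)                      ≡⟨ ℤₚ.pos-* (2 ℕ.* j ℕ.+ 1) m ⟩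
      + (2 ℕ.* j ℕ.+ 1) * M                          ∎

  term-congruence : ∀ j → + 4 * (Q * Q) ∣ℤ g (σ j) - (α * g j + β * w j)
  term-congruence j = divides (-1^ j * χ * + t j * + t j * R) (begin
    g (σ j) - (α * g j + β * w j)
      ≡⟨ cong₂ (λ u v → u - (α * g j + β * v)) g∘σ w≡ ⟩
    -1^ j * χ * (Y * Y ^ k * (M * M ^ k) - + K * (Y ^ k * M ^ k) * b + b * b * R)
      - (α * g j + β * (- -1^ j * Y ^ k * + t j))
      ≡⟨ cancel (-1^ j) χ Y (Y ^ k) M (M ^ k) Q (+ t j) R (+ K) ⟩
    -1^ j * χ * + t j * + t j * R * (+ 4 * (Q * Q)) ∎)
    where
    Y b R : ℤ
    Y = + (2 ℕ.* j ℕ.+ 1)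
    b = + 2 * Q * + t j
    R = proj₁ (binomial-mod-square k (Y * M) b)
    expansion : (Y * M - b) ^ K ≡ (Y * M) ^ K - + K * (Y * M) ^ k * b + b * b * R
    expansion = proj₂ (binomial-mod-square k (Y * M) b)
    g∘σ : g (σ j) ≡ -1^ j * χ * (Y * Y ^ k * (M * M ^ k) - + K * (Y ^ k * M ^ k) * b + b * b * R)
    g∘σ = begin
      -1^ (σ j) * (+ (2 ℕ.* σ j ℕ.+ 1)) ^ K
        ≡⟨ cong₂ (λ s x → s * x ^ K) (-1^σ j) (2σ+1 j) ⟩
      -1^ j * χ * (Y * M - b) ^ K
        ≡⟨ cong (-1^ j * χ *_) expansion ⟩
      -1^ j * χ * ((Y * M) ^ K - + K * (Y * M) ^ k * b + b * b * R)
        ≡⟨ cong₂ (λ u v → -1^ j * χ * (u - + K * v * b + b * b * R)) (^-distribʳ-* Y M K) (^-distribʳ-* Y M k) ⟩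
      -1^ j * χ * (Y * Y ^ k * (M * M ^ k) - + K * (Y ^ k * M ^ k) * b + b * b * R) ∎
    w≡ : w j ≡ - -1^ j * Y ^ k * + t j
    w≡ = cong₂ (λ y f → - -1^ j * y * + f) (pos-^ (2 ℕ.* j ℕ.+ 1) k)
               (cong (λ c → (j ℕ.* m ℕ.+ c) ℕ./ q) (m*n/n≡m h 2))
    cancel : ∀ s χ Y Yk M Mk Q T R K →
      s * χ * (Y * Yk * (M * Mk) - K * (Yk * Mk) * (+ 2 * Q * T) + (+ 2 * Q * T) * (+ 2 * Q * T) * R)
        - (χ * (M * Mk) * (s * (Y * Yk)) + + 2 * Q * K * χ * Mk * (- s * Yk * T))
      ≡ s * χ * T * T * R * (+ 4 * (Q * Q))
    cancel = solve-∀

  altPowerSum-permuted : + 4 * (Q * Q) ∣ℤ altPowerSum q K - (α * altPowerSum q K + β * S (suc n) k m)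
  altPowerSum-permuted =
    subst (+ 4 * (Q * Q) ∣ℤ_) (cong₂ _-_ (sumℤ-permute q σ g σ<q σ-injective) linear)
          (sumℤ-cong-∣ q (g ∘ σ) (λ j → α * g j + β * w j) (λ {j} _ → term-congruence j))
    where
    linear : sumℤ q (λ j → α * g j + β * w j) ≡ α * altPowerSum q K + β * S (suc n) k m
    linear = trans (sumℤ-distrib-+ q _ _) (sym (cong₂ _+_ (*-distribˡ-sumℤ q α g) (*-distribˡ-sumℤ q β w)))

-1^-square : ∀ h → -1^ h * -1^ h ≡ + 1
-1^-square h = begin
  -1^ h * -1^ h          ≡⟨ ℤₚ.^-distribˡ-+-* (- + 1) h h ⟨
  -1^ (h ℕ.+ h)          ≡⟨ cong (λ x → -1^ (h ℕ.+ x)) (ℕₚ.+-identityʳ h) ⟨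
  -1^ (2 ℕ.* h)          ≡⟨ -1^-even h ⟩
  + 1                    ∎

eliminate-A : ∀ {d} A K Q E χ MK Mk S → χ * χ ≡ + 1 →
  d ∣ℤ A + K * Q * E → d ∣ℤ A - (χ * MK * A + + 2 * Q * K * χ * Mk * S) →
  d ∣ℤ Q * (K * ((MK - χ) * E - + 2 * Mk * S))
eliminate-A {d} A K Q E χ MK Mk S χ²≡1 d∣A+KQE d∣A-χ[…] =
  subst (d ∣ℤ_) (sym (begin
    Q * (K * ((MK - χ) * E - + 2 * Mk * S))
      ≡⟨ combine A K Q E χ MK Mk S ⟩
    χ * (A - (χ * MK * A + + 2 * Q * K * χ * Mk * S)) - (χ - MK) * (A + K * Q * E) + (χ * χ - + 1) * X
      ≡⟨ cong (λ c → χ * (A - (χ * MK * A + + 2 * Q * K * χ * Mk * S)) - (χ - MK) * (A + K * Q * E) + (c - + 1) * X)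
              χ²≡1 ⟩
    χ * (A - (χ * MK * A + + 2 * Q * K * χ * Mk * S)) - (χ - MK) * (A + K * Q * E) + (+ 1 - + 1) * X
      ≡⟨ drop _ X ⟩
    χ * (A - (χ * MK * A + + 2 * Q * K * χ * Mk * S)) - (χ - MK) * (A + K * Q * E) ∎))
  (∣m∣n⇒∣m-n (∣n⇒∣m*n χ d∣A-χ[…]) (∣n⇒∣m*n (χ - MK) d∣A+KQE))
  where
  X : ℤ
  X = MK * A + + 2 * Q * K * Mk * S
  combine : ∀ A K Q E χ MK Mk S →
    Q * (K * ((MK - χ) * E - + 2 * Mk * S))
    ≡ χ * (A - (χ * MK * A + + 2 * Q * K * χ * Mk * S)) - (χ - MK) * (A + K * Q * E)
      + (χ * χ - + 1) * (MK * A + + 2 * Q * K * Mk * S)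
  combine = solve-∀
  drop : ∀ a x → a + (+ 1 - + 1) * x ≡ a
  drop = solve-∀

euler-congruence : ∀ n h k → 2 ∣ k →
  + 4 * + (2 ℕ.^ suc n) ∣ℤ ((+ suc (h ℕ.* 2)) ^ suc k - -1^ h) * euler k
                           - + 2 * (+ suc (h ℕ.* 2)) ^ k * S (suc n) k (suc (h ℕ.* 2))
euler-congruence n h k k-even@(divides k₀ k≡k₀*2) =
  subst (_∣ℤ G) (sym 4Q≡2^[3+n]) (2^a∣odd*x⇒2^a∣x (3 ℕ.+ n) k₀ (subst₂ _∣ℤ_ 4Q≡2^[3+n] (cong (_* G) K≡odd) 4Q∣KG))
  where
  open Permuted n h k
  G : ℤ
  G = (M ^ K - χ) * euler k - + 2 * M ^ k * S (suc n) k m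
  4QQ∣QKG : + 4 * (Q * Q) ∣ℤ Q * (+ K * G)
  4QQ∣QKG = eliminate-A (altPowerSum q K) (+ K) Q (euler k) χ (M ^ K) (M ^ k) (S (suc n) k m) (-1^-square h)
    (altPowerSum-congruence q k (divides (2 ℕ.^ n) (ℕₚ.*-comm 2 (2 ℕ.^ n))) k-even) altPowerSum-permuted
  4Q∣KG : + 4 * Q ∣ℤ + K * G
  4Q∣KG = *-cancelˡ-∣ Q (subst (_∣ℤ Q * (+ K * G)) (reorder Q) 4QQ∣QKG)
    where
    reorder : ∀ Q → + 4 * (Q * Q) ≡ Q * (+ 4 * Q)
    reorder = solve-∀
  4Q≡2^[3+n] : + 4 * Q ≡ + (2 ℕ.^ (3 ℕ.+ n))
  4Q≡2^[3+n] = trans (sym (ℤₚ.pos-* 4 q)) (cong +_ (ℕₚ.*-assoc 2 2 q))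
  K≡odd : + K ≡ + suc (k₀ ℕ.* 2)
  K≡odd = cong (λ x → + suc x) k≡k₀*2

fromℤ : ℤ → ℚ
fromℤ z = mkℚ z 0 (coprime-sym (1-coprimeTo ∣ z ∣))

toℚᵘ-/ : ∀ i d → ℚ.toℚᵘ (i ℚ./ suc d) ℚᵘ.≃ mkℚᵘ i d
toℚᵘ-/ i d = ℚₚ.toℚᵘ-fromℚᵘ (mkℚᵘ i d)

EulerCongruence : ℕ → ℕ → ℤ → ℤ → ℤ → Set
EulerCongruence n k x y s = ((x ℚ./ 4) ℚ.* (euler k ℚ./ 1)) ≡ ((y ℚ./ 2) ℚ.* (s ℚ./ 1)) [modℚ 2 ℕ.^ n ]

∣ℤ⇒≡[modℚ] : ∀ x e y s q → + 4 * + q ∣ℤ x * e - + 2 * y * s →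
  ((x ℚ./ 4) ℚ.* (e ℚ./ 1)) ≡ ((y ℚ./ 2) ℚ.* (s ℚ./ 1)) [modℚ q ]
∣ℤ⇒≡[modℚ] x e y s q (divides d eq) = fromℤ d , 1-coprimeTo q , ℚₚ.toℚᵘ-injective (
  ℚᵘₚ.≃-trans (ℚₚ.toℚᵘ-homo-+ α (ℚ.- β)) (
  ℚᵘₚ.≃-trans (ℚᵘₚ.+-congʳ (ℚ.toℚᵘ α) (ℚₚ.toℚᵘ-homo‿- β)) (
  ℚᵘₚ.≃-trans (ℚᵘₚ.+-cong (toℚᵘ-* x 3 e) (ℚᵘₚ.-‿cong (toℚᵘ-* y 1 s))) (
  ℚᵘₚ.≃-trans (*≡* cross-multiplied) (
  ℚᵘₚ.≃-sym (ℚᵘₚ.≃-trans (ℚₚ.toℚᵘ-homo-* (+ q ℚ./ 1) (fromℤ d)) (ℚᵘₚ.*-cong (toℚᵘ-/ (+ q) 0) ℚᵘₚ.≃-refl)))))))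
  where
  α β : ℚ
  α = (x ℚ./ 4) ℚ.* (e ℚ./ 1)
  β = (y ℚ./ 2) ℚ.* (s ℚ./ 1)
  toℚᵘ-* : ∀ i d j → ℚ.toℚᵘ ((i ℚ./ suc d) ℚ.* (j ℚ./ 1)) ℚᵘ.≃ mkℚᵘ i d ℚᵘ.* mkℚᵘ j 0
  toℚᵘ-* i d j = ℚᵘₚ.≃-trans (ℚₚ.toℚᵘ-homo-* (i ℚ./ suc d) (j ℚ./ 1)) (ℚᵘₚ.*-cong (toℚᵘ-/ i d) (toℚᵘ-/ j 0))
  cross-multiplied : (x * e * + 2 + - (y * s) * + 4) * + 1 ≡ + q * d * + 8
  cross-multiplied = trans (expand x e y s) (trans (cong (+ 2 *_) eq) (regroup (+ q) d))
    where
    expand : ∀ x e y s → (x * e * + 2 + - (y * s) * + 4) * + 1 ≡ + 2 * (x * e - + 2 * y * s)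
    expand = solve-∀
    regroup : ∀ q d → + 2 * (d * (+ 4 * q)) ≡ q * d * + 8
    regroup = solve-∀

OddModulusCongruence : ℕ → ℕ → ℕ → Set
OddModulusCongruence n k m =
  EulerCongruence n k (+ (m ℕ.^ (k ℕ.+ 1)) - (- + 1) ^ ((m ℕ.∸ 1) ℕ./ 2)) (+ (m ℕ.^ k)) (S n k m)

odd-modulus-congruence : ∀ n k h → 2 ∣ k → OddModulusCongruence (suc n) k (suc (h ℕ.* 2))
odd-modulus-congruence n k h k-even =
  ∣ℤ⇒≡[modℚ] (+ (m ℕ.^ (k ℕ.+ 1)) - (- + 1) ^ ((m ℕ.∸ 1) ℕ./ 2)) (euler k) (+ (m ℕ.^ k)) (S (suc n) k m) (2 ℕ.^ suc n)
    (subst₂ (λ x y → + 4 * + (2 ℕ.^ suc n) ∣ℤ x * euler k - + 2 * y * S (suc n) k m)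
            (sym numerator) (sym (pos-^ m k)) (euler-congruence n h k k-even))
  where
  m : ℕ
  m = suc (h ℕ.* 2)
  numerator : + (m ℕ.^ (k ℕ.+ 1)) - (- + 1) ^ ((m ℕ.∸ 1) ℕ./ 2) ≡ (+ m) ^ suc k - -1^ h
  numerator = cong₂ _-_ (trans (cong (λ e → + (m ℕ.^ e)) (ℕₚ.+-comm k 1)) (pos-^ m (suc k)))
                        (cong -1^_ (m*n/n≡m h 2))

odd⇒suc[half*2] : ∀ m → m ℕ.% 2 ≡ 1 → m ≡ suc (m ℕ./ 2 ℕ.* 2)
odd⇒suc[half*2] m m-odd = trans (m≡m%n+[m/n]*n m 2) (cong (ℕ._+ m ℕ./ 2 ℕ.* 2) m-odd)

theorem1p1 : (n k : ℕ) → 1 ≤ n → 2 ∣ k →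
    ((((+ (3 ℕ.^ (k ℕ.+ 1) ℕ.+ 1)) ℚ./ 4) ℚ.* ((euler k) ℚ./ 1))
       ≡ (((+ (3 ℕ.^ k)) ℚ./ 2) ℚ.* ((S3 n k) ℚ./ 1)) [modℚ 2 ℕ.^ n ])
    × ((m : ℕ) → m ℕ.% 2 ≡ 1 →
       (((((+ (m ℕ.^ (k ℕ.+ 1))) ℤ.- ((ℤ.- (+ 1)) ℤ.^ ((m ℕ.∸ 1) ℕ./ 2))) ℚ./ 4)
           ℚ.* ((euler k) ℚ./ 1))
         ≡ (((+ (m ℕ.^ k)) ℚ./ 2) ℚ.* ((S n k m) ℚ./ 1)) [modℚ 2 ℕ.^ n ]))
theorem1p1 (suc n) k (s≤s z≤n) k-even =
    subst₂ (λ x s → EulerCongruence (suc n) k x (+ (3 ℕ.^ k)) s) numerator S≡S3 (odd-modulus-congruence n k 1 k-even)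
  , λ m m-odd → subst (OddModulusCongruence (suc n) k) (sym (odd⇒suc[half*2] m m-odd))
                      (odd-modulus-congruence n k (m ℕ./ 2) k-even)
  where
  numerator : + (3 ℕ.^ (k ℕ.+ 1)) - (- + 1) ^ 1 ≡ + (3 ℕ.^ (k ℕ.+ 1) ℕ.+ 1)
  numerator = trans (plus-one (+ (3 ℕ.^ (k ℕ.+ 1)))) (sym (ℤₚ.pos-+ (3 ℕ.^ (k ℕ.+ 1)) 1))
    where
    plus-one : ∀ x → x - (- + 1) ^ 1 ≡ x + + 1
    plus-one = solve-∀
  S≡S3 : S (suc n) k 3 ≡ S3 (suc n) k
  S≡S3 = sumℤ-cong (2 ℕ.^ suc n) (λ {j} _ →
    cong (λ i → - -1^ j * + ((2 ℕ.* j ℕ.+ 1) ℕ.^ k) * + ((i ℕ.+ 1) div2^ suc n)) (ℕₚ.*-comm j 3))
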